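{- Let \[ M=\begin{pmatrix}2&4&6&0&6\\0&3&1&1&2\\2&0&0&0&0\\0&2&0&0&0\\0&0&2&0&2\end{pmatrix},\quad W=\begin{pmatrix}0&0&0&0&0\\0&0&0&0&0\\1&0&0&0&0\\0&1&0&0&0\\0&0&1&0&1\end{pmatrix},\quad U=(1,0,1,0,1),\quad \tilde U_0=(0,0,0,0,1)^t, \] with $U$ a row vector and $\tilde U_0$ a column vector. Then (1) $U\tilde U_0=1$; (2) $UW=U$; (3) $UMW=8U$; (4) $UM^2W=UM+40U$. Consequently, if $C$ is a product of matrices each equal to $M$ or $W$, then $UC=U(pM^2+qM+rI)$ for some integers $p,q,r$, where $I$ is the $5\times5$ identity matrix. -}

module Defs where

open import Data.Fin using (Fin; zero; suc)
open import Data.Integer using (ℤ; +_; _+_; _*_)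
open import Data.List.NonEmpty using (List⁺; foldr₁; map)
open import Relation.Binary.PropositionalEquality using (_≡_)

infixl 7 _⊗_ _·ᵣ_
infixl 8 _•_ _•ᵥ_
infixl 6 _⊕_ _⊕ᵥ_
infix 4 _≋_

Mat : Set
Mat = Fin 5 → Fin 5 → ℤ

Vec5 : Set
Vec5 = Fin 5 → ℤ

Σ5 : (Fin 5 → ℤ) → ℤ
Σ5 f = f zero + (f (suc zero) + (f (suc (suc zero)) + (f (suc (suc (suc zero))) + f (suc (suc (suc (suc zero)))))))

_⊗_ : Mat → Mat → Mat
(A ⊗ B) i j = Σ5 (λ k → A i k * B k j)

_·ᵣ_ : Vec5 → Mat → Vec5
(u ·ᵣ A) j = Σ5 (λ k → u k * A k j)

dot : Vec5 → Vec5 → ℤ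
dot u v = Σ5 (λ k → u k * v k)

_⊕_ : Mat → Mat → Mat
(A ⊕ B) i j = A i j + B i j

_•_ : ℤ → Mat → Mat
(c • A) i j = c * A i j

_•ᵥ_ : ℤ → Vec5 → Vec5
(c •ᵥ u) j = c * u j

_⊕ᵥ_ : Vec5 → Vec5 → Vec5
(u ⊕ᵥ v) j = u j + v j

_≋_ : Vec5 → Vec5 → Set
u ≋ v = ∀ j → u j ≡ v j

mat : (r0 r1 r2 r3 r4 : Fin 5 → ℤ) → Mat
mat r0 r1 r2 r3 r4 zero = r0
mat r0 r1 r2 r3 r4 (suc zero) = r1
mat r0 r1 r2 r3 r4 (suc (suc zero)) = r2
mat r0 r1 r2 r3 r4 (suc (suc (suc zero))) = r3
mat r0 r1 r2 r3 r4 (suc (suc (suc (suc zero)))) = r4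

vec : (a b c d e : ℤ) → Vec5
vec a b c d e zero = a
vec a b c d e (suc zero) = b
vec a b c d e (suc (suc zero)) = c
vec a b c d e (suc (suc (suc zero))) = d
vec a b c d e (suc (suc (suc (suc zero)))) = e

M : Mat
M = mat (vec (+ 2) (+ 4) (+ 6) (+ 0) (+ 6))
        (vec (+ 0) (+ 3) (+ 1) (+ 1) (+ 2))
        (vec (+ 2) (+ 0) (+ 0) (+ 0) (+ 0))
        (vec (+ 0) (+ 2) (+ 0) (+ 0) (+ 0))
        (vec (+ 0) (+ 0) (+ 2) (+ 0) (+ 2))

W : Mat
W = mat (vec (+ 0) (+ 0) (+ 0) (+ 0) (+ 0))
        (vec (+ 0) (+ 0) (+ 0) (+ 0) (+ 0))
        (vec (+ 1) (+ 0) (+ 0) (+ 0) (+ 0))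
        (vec (+ 0) (+ 1) (+ 0) (+ 0) (+ 0))
        (vec (+ 0) (+ 0) (+ 1) (+ 0) (+ 1))

I : Mat
I = mat (vec (+ 1) (+ 0) (+ 0) (+ 0) (+ 0))
        (vec (+ 0) (+ 1) (+ 0) (+ 0) (+ 0))
        (vec (+ 0) (+ 0) (+ 1) (+ 0) (+ 0))
        (vec (+ 0) (+ 0) (+ 0) (+ 1) (+ 0))
        (vec (+ 0) (+ 0) (+ 0) (+ 0) (+ 1))

U : Vec5
U = vec (+ 1) (+ 0) (+ 1) (+ 0) (+ 1)

U₀ : Vec5
U₀ = vec (+ 0) (+ 0) (+ 0) (+ 0) (+ 1)

data Factor : Set where
  fM fW : Factor

⟦_⟧ : Factor → Mat
⟦ fM ⟧ = M
⟦ fW ⟧ = W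

prod : List⁺ Factor → Mat
prod w = foldr₁ _⊗_ (map ⟦_⟧ w)

{-# OPTIONS --safe #-}
-- The row vectors UM², UM and U span a ℤ-module that is invariant under M, since
-- UM³ = 7UM² − 2UM − 24U, and under W, which by (2)–(4) sends U, UM, UM² to U, 8U, UM + 40U.
-- Hence UC lies in the span for every product C, and
-- pUM² + qUM + rU is exactly U(pM² + qM + rI).
module Submission where

open import Defs
open import Data.Fin using (Fin; zero; suc)
open import Data.Integer using (ℤ; +_; -_; _+_; _*_)
open import Data.Integer.Properties using (+-*-semiring; +-identityʳ; *-assoc; *-distribˡ-+; *-distribʳ-+; *-commutativeSemigroup)
open import Algebra.Properties.CommutativeSemigroup *-commutativeSemigroup using (x∙yz≈y∙xz)
open import Data.Integer.Tactic.RingSolver using (solve-∀)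
open import Data.List using ([]; _∷_)
open import Data.List.NonEmpty using (List⁺; _∷_)
open import Data.Product using (_×_; _,_; ∃-syntax)
open import Relation.Binary.PropositionalEquality using (_≡_; refl; sym; trans; cong; cong₂; module ≡-Reasoning)

open import Algebra.Properties.Semiring.Sum +-*-semiring using (sum; ∑-distrib-+; ∑-comm; *-distribˡ-sum; *-distribʳ-sum)

Σ5≡sum : ∀ f → Σ5 f ≡ sum f
Σ5≡sum f = cong (λ t → f zero + (f (suc zero) + (f (suc (suc zero)) + (f (suc (suc (suc zero))) + t))))
                (sym (+-identityʳ _))

Σ5-cong : ∀ {f g} → (∀ k → f k ≡ g k) → Σ5 f ≡ Σ5 g
Σ5-cong f≗g = cong₂ _+_ (f≗g _) (cong₂ _+_ (f≗g _) (cong₂ _+_ (f≗g _) (cong₂ _+_ (f≗g _) (f≗g _))))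

Σ5-distrib-+ : ∀ f g → Σ5 (λ k → f k + g k) ≡ Σ5 f + Σ5 g
Σ5-distrib-+ f g = begin
  Σ5 (λ k → f k + g k)  ≡⟨ Σ5≡sum (λ k → f k + g k) ⟩
  sum (λ k → f k + g k) ≡⟨ ∑-distrib-+ f g ⟩
  sum f + sum g         ≡⟨ sym (cong₂ _+_ (Σ5≡sum f) (Σ5≡sum g)) ⟩
  Σ5 f + Σ5 g           ∎
  where open ≡-Reasoning

*-distribˡ-Σ5 : ∀ c f → c * Σ5 f ≡ Σ5 (λ k → c * f k)
*-distribˡ-Σ5 c f = begin
  c * Σ5 f              ≡⟨ cong (c *_) (Σ5≡sum f) ⟩
  c * sum f             ≡⟨ *-distribˡ-sum c f ⟩
  sum (λ k → c * f k)   ≡⟨ sym (Σ5≡sum (λ k → c * f k)) ⟩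
  Σ5 (λ k → c * f k)    ∎
  where open ≡-Reasoning

*-distribʳ-Σ5 : ∀ c f → Σ5 f * c ≡ Σ5 (λ k → f k * c)
*-distribʳ-Σ5 c f = begin
  Σ5 f * c              ≡⟨ cong (_* c) (Σ5≡sum f) ⟩
  sum f * c             ≡⟨ *-distribʳ-sum c f ⟩
  sum (λ k → f k * c)   ≡⟨ sym (Σ5≡sum (λ k → f k * c)) ⟩
  Σ5 (λ k → f k * c)    ∎
  where open ≡-Reasoning

Σ5-comm : ∀ (g : Fin 5 → Fin 5 → ℤ) → Σ5 (λ k → Σ5 (g k)) ≡ Σ5 (λ l → Σ5 (λ k → g k l))
Σ5-comm g = begin
  Σ5 (λ k → Σ5 (g k))                ≡⟨ Σ5-cong (λ k → Σ5≡sum (g k)) ⟩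
  Σ5 (λ k → sum (g k))               ≡⟨ Σ5≡sum (λ k → sum (g k)) ⟩
  sum (λ k → sum (g k))              ≡⟨ ∑-comm g ⟩
  sum (λ l → sum (λ k → g k l))      ≡⟨ sym (Σ5≡sum (λ l → sum (λ k → g k l))) ⟩
  Σ5 (λ l → sum (λ k → g k l))       ≡⟨ sym (Σ5-cong (λ l → Σ5≡sum (λ k → g k l))) ⟩
  Σ5 (λ l → Σ5 (λ k → g k l))        ∎
  where open ≡-Reasoning

≋-sym : ∀ {u v} → u ≋ v → v ≋ u
≋-sym u≋v j = sym (u≋v j)

≋-trans : ∀ {u v w} → u ≋ v → v ≋ w → u ≋ w
≋-trans u≋v v≋w j = trans (u≋v j) (v≋w j)

entrywise : ∀ {u v : Vec5} →
            u zero ≡ v zero → u (suc zero) ≡ v (suc zero) → u (suc (suc zero)) ≡ v (suc (suc zero)) →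
            u (suc (suc (suc zero))) ≡ v (suc (suc (suc zero))) →
            u (suc (suc (suc (suc zero)))) ≡ v (suc (suc (suc (suc zero)))) → u ≋ v
entrywise e₀ e₁ e₂ e₃ e₄ zero = e₀
entrywise e₀ e₁ e₂ e₃ e₄ (suc zero) = e₁
entrywise e₀ e₁ e₂ e₃ e₄ (suc (suc zero)) = e₂
entrywise e₀ e₁ e₂ e₃ e₄ (suc (suc (suc zero))) = e₃
entrywise e₀ e₁ e₂ e₃ e₄ (suc (suc (suc (suc zero)))) = e₄

·ᵣ-congˡ : ∀ {u v} A → u ≋ v → u ·ᵣ A ≋ v ·ᵣ A
·ᵣ-congˡ A u≋v j = Σ5-cong (λ k → cong (_* A k j) (u≋v k))

·ᵣ-assoc : ∀ u A B → u ·ᵣ (A ⊗ B) ≋ (u ·ᵣ A) ·ᵣ B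
·ᵣ-assoc u A B j = begin
  Σ5 (λ k → u k * Σ5 (λ l → A k l * B l j))        ≡⟨ Σ5-cong (λ k → *-distribˡ-Σ5 (u k) (λ l → A k l * B l j)) ⟩
  Σ5 (λ k → Σ5 (λ l → u k * (A k l * B l j)))      ≡⟨ Σ5-cong (λ k → Σ5-cong (λ l → sym (*-assoc (u k) (A k l) (B l j)))) ⟩
  Σ5 (λ k → Σ5 (λ l → u k * A k l * B l j))        ≡⟨ Σ5-comm (λ k l → u k * A k l * B l j) ⟩
  Σ5 (λ l → Σ5 (λ k → u k * A k l * B l j))        ≡⟨ Σ5-cong (λ l → sym (*-distribʳ-Σ5 (B l j) (λ k → u k * A k l))) ⟩
  Σ5 (λ l → Σ5 (λ k → u k * A k l) * B l j)        ∎
  where open ≡-Reasoning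

·ᵣ-distribʳ-⊕ᵥ : ∀ u v A → (u ⊕ᵥ v) ·ᵣ A ≋ u ·ᵣ A ⊕ᵥ v ·ᵣ A
·ᵣ-distribʳ-⊕ᵥ u v A j =
  trans (Σ5-cong (λ k → *-distribʳ-+ (A k j) (u k) (v k)))
        (Σ5-distrib-+ (λ k → u k * A k j) (λ k → v k * A k j))

·ᵣ-distribˡ-⊕ : ∀ u A B → u ·ᵣ (A ⊕ B) ≋ u ·ᵣ A ⊕ᵥ u ·ᵣ B
·ᵣ-distribˡ-⊕ u A B j =
  trans (Σ5-cong (λ k → *-distribˡ-+ (u k) (A k j) (B k j)))
        (Σ5-distrib-+ (λ k → u k * A k j) (λ k → u k * B k j))

•ᵥ-·ᵣ : ∀ c u A → (c •ᵥ u) ·ᵣ A ≋ c •ᵥ (u ·ᵣ A)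
•ᵥ-·ᵣ c u A j =
  trans (Σ5-cong (λ k → *-assoc c (u k) (A k j))) (sym (*-distribˡ-Σ5 c (λ k → u k * A k j)))

·ᵣ-• : ∀ u c A → u ·ᵣ (c • A) ≋ c •ᵥ (u ·ᵣ A)
·ᵣ-• u c A j =
  trans (Σ5-cong (λ k → x∙yz≈y∙xz (u k) c (A k j))) (sym (*-distribˡ-Σ5 c (λ k → u k * A k j)))

module Span (x y z : Vec5) where

  span : ℤ → ℤ → ℤ → Vec5
  span p q r = p •ᵥ x ⊕ᵥ q •ᵥ y ⊕ᵥ r •ᵥ z

  InSpan : Vec5 → Set
  InSpan v = ∃[ p ] ∃[ q ] ∃[ r ] v ≋ span p q r

  InSpan-resp-≋ : ∀ {u v} → u ≋ v → InSpan v → InSpan u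
  InSpan-resp-≋ u≋v (p , q , r , v≋span) = p , q , r , ≋-trans u≋v v≋span

  x∈span : InSpan x
  x∈span = + 1 , + 0 , + 0 , λ j → coefficients (x j) (y j) (z j)
    where
    coefficients : ∀ a b c → a ≡ + 1 * a + + 0 * b + + 0 * c
    coefficients = solve-∀

  y∈span : InSpan y
  y∈span = + 0 , + 1 , + 0 , λ j → coefficients (x j) (y j) (z j)
    where
    coefficients : ∀ a b c → b ≡ + 0 * a + + 1 * b + + 0 * c
    coefficients = solve-∀

  z∈span : InSpan z
  z∈span = + 0 , + 0 , + 1 , λ j → coefficients (x j) (y j) (z j)
    where
    coefficients : ∀ a b c → c ≡ + 0 * a + + 0 * b + + 1 * c
    coefficients = solve-∀

  InSpan-⊕ᵥ : ∀ {u v} → InSpan u → InSpan v → InSpan (u ⊕ᵥ v)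
  InSpan-⊕ᵥ (p , q , r , u≋) (p′ , q′ , r′ , v≋) =
    p + p′ , q + q′ , r + r′ , λ j → trans (cong₂ _+_ (u≋ j) (v≋ j)) (collect p q r p′ q′ r′ (x j) (y j) (z j))
    where
    collect : ∀ p q r p′ q′ r′ a b c →
              (p * a + q * b + r * c) + (p′ * a + q′ * b + r′ * c) ≡ (p + p′) * a + (q + q′) * b + (r + r′) * c
    collect = solve-∀

  InSpan-•ᵥ : ∀ k {v} → InSpan v → InSpan (k •ᵥ v)
  InSpan-•ᵥ k (p , q , r , v≋) =
    k * p , k * q , k * r , λ j → trans (cong (k *_) (v≋ j)) (distribute k p q r (x j) (y j) (z j))
    where
    distribute : ∀ k p q r a b c → k * (p * a + q * b + r * c) ≡ k * p * a + k * q * b + k * r * c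
    distribute = solve-∀

  Invariant : Mat → Set
  Invariant A = ∀ {v} → InSpan v → InSpan (v ·ᵣ A)

  invariant : ∀ A → InSpan (x ·ᵣ A) → InSpan (y ·ᵣ A) → InSpan (z ·ᵣ A) → Invariant A
  invariant A xA yA zA (p , q , r , v≋) =
    InSpan-resp-≋ (≋-trans (·ᵣ-congˡ A v≋) linear)
      (InSpan-⊕ᵥ (InSpan-⊕ᵥ (InSpan-•ᵥ p xA) (InSpan-•ᵥ q yA)) (InSpan-•ᵥ r zA))
    where
    linear : span p q r ·ᵣ A ≋ p •ᵥ (x ·ᵣ A) ⊕ᵥ q •ᵥ (y ·ᵣ A) ⊕ᵥ r •ᵥ (z ·ᵣ A)
    linear j = trans (·ᵣ-distribʳ-⊕ᵥ (p •ᵥ x ⊕ᵥ q •ᵥ y) (r •ᵥ z) A j)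
      (cong₂ _+_ (trans (·ᵣ-distribʳ-⊕ᵥ (p •ᵥ x) (q •ᵥ y) A j)
                        (cong₂ _+_ (•ᵥ-·ᵣ p x A j) (•ᵥ-·ᵣ q y A j)))
                 (•ᵥ-·ᵣ r z A j))

  Invariant-⊗ : ∀ {A B} → Invariant A → Invariant B → Invariant (A ⊗ B)
  Invariant-⊗ {A} {B} invA invB {v} v∈ = InSpan-resp-≋ (·ᵣ-assoc v A B) (invB (invA v∈))

  Invariant-prod : (∀ F → Invariant ⟦ F ⟧) → ∀ C → Invariant (prod C)
  Invariant-prod inv (F ∷ C) = go F C
    where
    go : ∀ F C → Invariant (prod (F ∷ C))
    go F []      = inv F
    go F (G ∷ C) = Invariant-⊗ {⟦ F ⟧} {prod (G ∷ C)} (inv F) (go G C)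

UM UM² : Vec5
UM  = U ·ᵣ M
UM² = UM ·ᵣ M

open Span UM² UM U

U·W≋U : U ·ᵣ W ≋ U
U·W≋U = entrywise refl refl refl refl refl

U·MW≋8U : U ·ᵣ (M ⊗ W) ≋ (+ 8) •ᵥ U
U·MW≋8U = entrywise refl refl refl refl refl

U·MMW≋UM+40U : U ·ᵣ ((M ⊗ M) ⊗ W) ≋ UM ⊕ᵥ (+ 40) •ᵥ U
U·MMW≋UM+40U = entrywise refl refl refl refl refl

UM³≋7UM²-2UM-24U : UM² ·ᵣ M ≋ span (+ 7) (- + 2) (- + 24)
UM³≋7UM²-2UM-24U = entrywise refl refl refl refl refl

U·I≋U : U ·ᵣ I ≋ U
U·I≋U = entrywise refl refl refl refl refl

M-invariant : Invariant M
M-invariant = invariant M (+ 7 , - + 2 , - + 24 , UM³≋7UM²-2UM-24U) x∈span y∈span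

W-invariant : Invariant W
W-invariant = invariant W UM²·W∈span UM·W∈span (InSpan-resp-≋ U·W≋U z∈span)
  where
  UM²·W∈span : InSpan (UM² ·ᵣ W)
  UM²·W∈span = InSpan-resp-≋
    (≋-trans (≋-sym (≋-trans (·ᵣ-assoc U (M ⊗ M) W) (·ᵣ-congˡ W (·ᵣ-assoc U M M)))) U·MMW≋UM+40U)
    (InSpan-⊕ᵥ y∈span (InSpan-•ᵥ (+ 40) z∈span))

  UM·W∈span : InSpan (UM ·ᵣ W)
  UM·W∈span = InSpan-resp-≋ (≋-trans (≋-sym (·ᵣ-assoc U M W)) U·MW≋8U) (InSpan-•ᵥ (+ 8) z∈span)

factor-invariant : ∀ F → Invariant ⟦ F ⟧
factor-invariant fM = M-invariant
factor-invariant fW = W-invariant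

U·quadratic≋span : ∀ p q r → U ·ᵣ (((p • (M ⊗ M)) ⊕ (q • M)) ⊕ (r • I)) ≋ span p q r
U·quadratic≋span p q r j =
  trans (·ᵣ-distribˡ-⊕ U (p • (M ⊗ M) ⊕ q • M) (r • I) j)
    (cong₂ _+_
      (trans (·ᵣ-distribˡ-⊕ U (p • (M ⊗ M)) (q • M) j)
             (cong₂ _+_ (trans (·ᵣ-• U p (M ⊗ M) j) (cong (p *_) (·ᵣ-assoc U M M j)))
                        (·ᵣ-• U q M j)))
      (trans (·ᵣ-• U r I j) (cong (r *_) (U·I≋U j))))

lemma10 : (dot U U₀ ≡ + 1)
            × ((U ·ᵣ W) ≋ U)
            × ((U ·ᵣ (M ⊗ W)) ≋ ((+ 8) •ᵥ U))
            × ((U ·ᵣ ((M ⊗ M) ⊗ W)) ≋ ((U ·ᵣ M) ⊕ᵥ ((+ 40) •ᵥ U)))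
            × ((C : List⁺ Factor) → ∃[ p ] ∃[ q ] ∃[ r ]
                 ((U ·ᵣ prod C) ≋ (U ·ᵣ (((p • (M ⊗ M)) ⊕ (q • M)) ⊕ (r • I)))))
lemma10 = refl , U·W≋U , U·MW≋8U , U·MMW≋UM+40U , U·prod∈quadratic
  where
  U·prod∈quadratic : (C : List⁺ Factor) → ∃[ p ] ∃[ q ] ∃[ r ]
                       ((U ·ᵣ prod C) ≋ (U ·ᵣ (((p • (M ⊗ M)) ⊕ (q • M)) ⊕ (r • I))))
  U·prod∈quadratic C =
    let (p , q , r , U·C≋span) = Invariant-prod factor-invariant C z∈span
    in  p , q , r , ≋-trans U·C≋span (≋-sym (U·quadratic≋span p q r))
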